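{- If $G$ is a graph on $n$ vertices with edge-connectivity $\lambda(G)\geq 2n$, then $\mathrm{sn}_2(G)=\mathrm{gon}_2(G)=2n$.
   Context: A graph is a finite, connected, undirected multigraph without loops. $\lambda(G)$ is the minimum number of edges whose deletion disconnects $G$. A vertex set $A$ is $2$-edge-connected if $G[A]$ remains connected after deleting any single edge (a single vertex counts). A $2$-scramble is a collection of nonempty $2$-edge-connected vertex subsets (eggs). $h_2(\mathcal S)$ is the minimum size of a multiset of vertices containing, counted with multiplicity, at least $2$ elements in each egg; $e(\mathcal S)$ is the minimum number of edges whose deletion disconnects $G$ into components at least two of which contain an egg; the order is $\min\{h_2(\mathcal S),e(\mathcal S)\}$ and $\mathrm{sn}_2(G)$ is the maximum order of a $2$-scramble. A divisor is $D=\sum_v D(v)(v)$, $\deg D=\sum D(v)$, effective if all $D(v)\ge0$; firing $v$ gives $D'(v)=D(v)-\mathrm{val}(v)$, $D'(w)=D(w)+(\#\text{edges }vw)$; linear equivalence is generated by firings; $r(D)=-1$ if $D$ is not equivalent to an effective divisor, else the largest $r\ge0$ with $D-E$ equivalent to an effective divisor for all effective $E$ of degree $r$. $\mathrm{gon}_2(G)$ is the minimum degree of a divisor of rank at least $2$. -}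

module Defs where

open import Data.Nat as ℕ using (ℕ; zero; suc; _∸_; _⊓_)
open import Data.Integer as ℤ using (ℤ; +_; -[1+_])
open import Data.Bool using (Bool; true; false; _∧_; _∨_; if_then_else_)
open import Data.Fin using (Fin; zero; suc; _≟_)
open import Data.Fin.Subset using (Subset; _∈_; Nonempty)
open import Data.Vec using (lookup)
open import Data.List using (List; length; filterᵇ; removeAt)
open import Data.List.Relation.Unary.All using (All)
import Data.List.Membership.Propositional as LM
import Data.List.Relation.Binary.Sublist.Propositional as SL
open import Data.Product using (Σ; ∃; _×_; _,_; proj₁; proj₂)
open import Data.Sum using (_⊎_)
open import Relation.Nullary using (¬_; ⌊_⌋)
open import Relation.Binary.PropositionalEquality using (_≡_; _≢_)
open import Relation.Binary.Construct.Closure.Equivalence using (EqClosure)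

IsLeast : {A : Set} → (A → A → Set) → (A → Set) → A → Set
IsLeast _≤_ P k = P k × (∀ j → P j → k ≤ j)

IsGreatest : {A : Set} → (A → A → Set) → (A → Set) → A → Set
IsGreatest _≤_ P k = P k × (∀ j → P j → j ≤ k)

sumFin : ∀ {n} → (Fin n → ℕ) → ℕ
sumFin {zero}  f = 0
sumFin {suc n} f = f zero ℕ.+ sumFin (λ i → f (suc i))

sumFinℤ : ∀ {n} → (Fin n → ℤ) → ℤ
sumFinℤ {zero}  f = + 0
sumFinℤ {suc n} f = f zero ℤ.+ sumFinℤ (λ i → f (suc i))

-- Multigraphs: vertex set Fin n, edges a list (multiset) of vertex pairs

Edge : ℕ → Set
Edge n = Fin n × Fin n

data Path {n} (F : List (Edge n)) : Fin n → Fin n → Set where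
  here : ∀ {u} → Path F u u
  step : ∀ {u w v} → (LM._∈_ (u , w) F ⊎ LM._∈_ (w , u) F) → Path F w v → Path F u v

Connected : ∀ {n} → List (Edge n) → Set
Connected {n} F = ∀ (u v : Fin n) → Path F u v

record Graph (n : ℕ) : Set where
  field
    edges     : List (Edge n)
    loopless  : All (λ e → proj₁ e ≢ proj₂ e) edges
    connected : Connected edges
open Graph public

deleted : ∀ {n} (G : Graph n) → List (Edge n) → ℕ
deleted G R = length (edges G) ∸ length R

-- λ(G) ≥ k : every set of edges whose deletion disconnects G has ≥ k edges
EdgeConnAtLeast : ∀ {n} → Graph n → ℕ → Set
EdgeConnAtLeast {n} G k =
  ∀ (R : List (Edge n)) → SL._⊆_ R (edges G) → ¬ Connected R → k ℕ.≤ deleted G R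

Induced : ∀ {n} → List (Edge n) → Subset n → List (Edge n)
Induced F A = filterᵇ (λ e → lookup A (proj₁ e) ∧ lookup A (proj₂ e)) F

ConnectedOn : ∀ {n} → List (Edge n) → Subset n → Set
ConnectedOn {n} F A = ∀ (u v : Fin n) → u ∈ A → v ∈ A → Path F u v

TwoEdgeConnected : ∀ {n} → Graph n → Subset n → Set
TwoEdgeConnected G A =
  ConnectedOn (Induced (edges G) A) A ×
  (∀ (i : Fin (length (Induced (edges G) A))) →
     ConnectedOn (removeAt (Induced (edges G) A) i) A)

Scramble : ∀ {n} → Graph n → List (Subset n) → Set
Scramble G S = All (λ A → Nonempty A × TwoEdgeConnected G A) S

-- number of elements (with multiplicity) of the multiset c lying in A
countIn : ∀ {n} → Subset n → (Fin n → ℕ) → ℕ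
countIn A c = sumFin (λ v → if lookup A v then c v else 0)

Hits2 : ∀ {n} → List (Subset n) → (Fin n → ℕ) → Set
Hits2 S c = All (λ A → 2 ℕ.≤ countIn A c) S

H2 : ∀ {n} → List (Subset n) → ℕ → Set
H2 {n} S = IsLeast ℕ._≤_ (λ j → Σ (Fin n → ℕ) λ c → Hits2 S c × sumFin c ≡ j)

-- deleting all edges not in R leaves components at least two of which
-- contain an egg
Separates : ∀ {n} (G : Graph n) → List (Subset n) → List (Edge n) → Set
Separates {n} G S R =
  SL._⊆_ R (edges G) ×
  Σ (Subset n) λ A → Σ (Subset n) λ B → LM._∈_ A S × LM._∈_ B S ×
  Σ (Fin n) λ a → Σ (Fin n) λ b → a ∈ A × b ∈ B ×
  (∀ x → x ∈ A → Path R a x) × (∀ y → y ∈ B → Path R b y) × ¬ Path R a b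

E2 : ∀ {n} → Graph n → List (Subset n) → ℕ → Set
E2 {n} G S = IsLeast ℕ._≤_ (λ j → Σ (List (Edge n)) λ R → Separates G S R × deleted G R ≡ j)

-- e(S) = ∞ : no such deletion exists
E2Infinite : ∀ {n} → Graph n → List (Subset n) → Set
E2Infinite G S = ∀ R → ¬ Separates G S R

Order : ∀ {n} → Graph n → List (Subset n) → ℕ → Set
Order G S k = Σ ℕ λ h → H2 S h ×
  ((Σ ℕ λ e → E2 G S e × k ≡ h ⊓ e) ⊎ (E2Infinite G S × k ≡ h))

Sn2 : ∀ {n} → Graph n → ℕ → Set
Sn2 {n} G = IsGreatest ℕ._≤_ (λ k → Σ (List (Subset n)) λ S → Scramble G S × Order G S k)

Divisor : ℕ → Set
Divisor n = Fin n → ℤ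

deg : ∀ {n} → Divisor n → ℤ
deg = sumFinℤ

mult : ∀ {n} → Graph n → Fin n → Fin n → ℕ
mult G v w = length (filterᵇ (λ e → (⌊ proj₁ e ≟ v ⌋ ∧ ⌊ proj₂ e ≟ w ⌋) ∨
                                     (⌊ proj₁ e ≟ w ⌋ ∧ ⌊ proj₂ e ≟ v ⌋)) (edges G))

-- valence of v (G is loopless)
val : ∀ {n} → Graph n → Fin n → ℕ
val G v = length (filterᵇ (λ e → ⌊ proj₁ e ≟ v ⌋ ∨ ⌊ proj₂ e ≟ v ⌋) (edges G))

fire : ∀ {n} → Graph n → Fin n → Divisor n → Divisor n
fire G v D w = if ⌊ w ≟ v ⌋ then D w ℤ.- + val G v else D w ℤ.+ + mult G v w

Fires : ∀ {n} → Graph n → Divisor n → Divisor n → Set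
Fires {n} G D D' = Σ (Fin n) λ v → ∀ w → D' w ≡ fire G v D w

LinEq : ∀ {n} → Graph n → Divisor n → Divisor n → Set
LinEq G = EqClosure (Fires G)

Effective : ∀ {n} → Divisor n → Set
Effective D = ∀ v → + 0 ℤ.≤ D v

EquivEffective : ∀ {n} → Graph n → Divisor n → Set
EquivEffective {n} G D = Σ (Divisor n) λ D' → LinEq G D D' × Effective D'

RankProp : ∀ {n} → Graph n → Divisor n → ℕ → Set
RankProp {n} G D k = ∀ (E : Fin n → ℕ) → sumFin E ≡ k →
  EquivEffective G (λ v → D v ℤ.- + E v)

Rank : ∀ {n} → Graph n → Divisor n → ℤ → Set
Rank G D r = (r ≡ -[1+ 0 ] × ¬ EquivEffective G D) ⊎
             (Σ ℕ λ k → r ≡ + k × IsGreatest ℕ._≤_ (RankProp G D) k)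

Gon2 : ∀ {n} → Graph n → ℤ → Set
Gon2 {n} G = IsLeast ℤ._≤_ (λ d → Σ (Divisor n) λ D → deg D ≡ d ×
  Σ ℤ λ r → Rank G D r × + 2 ℤ.≤ r)

-- The bound λ(G) ≥ 2n makes every cut of G at least as expensive as
-- placing two chips on every vertex. For sn₂: the multiset taking every vertex twice
-- meets every egg twice, so no scramble has order above 2n, while the scramble of all
-- singletons has h₂ = 2n and e = λ(G) ≥ 2n. For gon₂: the divisor 2·𝟙 has degree 2n
-- and rank 2. Conversely, if D − Lap h is effective for a non-constant firing script h,
-- the set U where h is maximal loses at least one chip along each of the ≥ λ(G) edges
-- leaving it, so D has at least λ(G) ≥ 2n chips on the proper subset U. Applied to
-- 2·𝟙 − j(v) this caps the rank of 2·𝟙 at 2; applied to D₀ − k(v), where D₀ is an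
-- effective divisor equivalent to a D of rank k ≥ 2 and D₀(v) < 2, it gives deg D ≥ 2n.

module Submission where

open import Defs
open import Data.Bool using (Bool; true; false; T; _∧_; _∨_; _xor_; not; if_then_else_)
open import Data.Empty using (⊥-elim)
open import Data.Fin using (Fin; zero; suc; _≟_; fromℕ<)
open import Data.Fin.Properties using (all?; ¬∀⟶∃¬)
open import Data.Fin.Subset using (Subset; _∈_; ⁅_⁆; Nonempty)
open import Data.Fin.Subset.Properties using (x∈⁅x⁆; x∈⁅y⁆⇒x≡y)
open import Data.List using (List; []; _∷_; length; filterᵇ; map; allFin)
open import Data.List.Relation.Unary.All as All using (All; []; _∷_)
open import Data.List.Relation.Unary.Any using (here; there)
open import Data.List.Membership.Propositional using (lose) renaming (_∈_ to _∈ₗ_)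
open import Data.List.Membership.Propositional.Properties using (∈-map⁺; ∈-map⁻; ∈-allFin; ∈-filter⁻)
open import Data.List.Relation.Binary.Sublist.Propositional using (_⊆_; []; _∷_; _∷ʳ_)
open import Data.List.Relation.Binary.Sublist.Propositional.Properties using (filter-⊆)
open import Data.Integer as ℤ using (ℤ; +_)
import Data.Integer.Properties as ℤ
open import Algebra.Properties.CommutativeSemigroup ℤ.+-commutativeSemigroup using (interchange)
open import Data.Integer.Tactic.RingSolver using (solve-∀)
open import Data.List.Extrema ℤ.≤-totalOrder using (argmax; v≤f[argmax]⁺)
open import Data.Nat as ℕ using (ℕ; zero; suc; z≤n; s≤s)
import Data.Nat.Properties as ℕ
open import Data.Product using (Σ; _×_; _,_; proj₁; proj₂)
open import Data.Sum using (_⊎_; inj₁; inj₂)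
open import Data.Vec using (lookup)
open import Data.Vec.Base using () renaming (here to lookup-here; there to lookup-there)
open import Data.Vec.Properties using (lookup-replicate)
open import Function using (_∘_)
open import Relation.Nullary using (¬_; Dec; yes; no; ⌊_⌋; ¬?)
open import Relation.Nullary.Decidable using (T?; map′; _×-dec_; _⊎-dec_)
open import Relation.Binary.PropositionalEquality
open import Relation.Binary.Construct.Closure.ReflexiveTransitive using (ε; _◅_)
open import Relation.Binary.Construct.Closure.Symmetric using (fwd; bwd)

Path-++ : ∀ {n} {F : List (Edge n)} {u v w} → Path F u v → Path F v w → Path F u w
Path-++ here q = q
Path-++ (step e p) q = step e (Path-++ p q)

Path-∷ : ∀ {n} {F : List (Edge n)} {e u v} → Path F u v → Path (e ∷ F) u v
Path-∷ here = here
Path-∷ (step (inj₁ m) p) = step (inj₁ (there m)) (Path-∷ p)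
Path-∷ (step (inj₂ m) p) = step (inj₂ (there m)) (Path-∷ p)

Path-[] : ∀ {n} {u v : Fin n} → Path [] u v → u ≡ v
Path-[] here = refl
Path-[] (step (inj₁ ()) _)
Path-[] (step (inj₂ ()) _)

module _ {n : ℕ} (F : List (Edge n)) (x y : Fin n) where

  ViaEdge : Fin n → Fin n → Set
  ViaEdge u v = Path F u v ⊎ (Path F u x × Path F y v) ⊎ (Path F u y × Path F x v)

  ViaEdge-prepend : ∀ {u w v} → Path F u w → ViaEdge w v → ViaEdge u v
  ViaEdge-prepend p (inj₁ q) = inj₁ (Path-++ p q)
  ViaEdge-prepend p (inj₂ (inj₁ (a , b))) = inj₂ (inj₁ (Path-++ p a , b))
  ViaEdge-prepend p (inj₂ (inj₂ (a , b))) = inj₂ (inj₂ (Path-++ p a , b))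

  Path-∷⁻ : ∀ {u v} → Path ((x , y) ∷ F) u v → ViaEdge u v
  Path-∷⁻ here = inj₁ here
  Path-∷⁻ (step (inj₁ (there m)) p) = ViaEdge-prepend (step (inj₁ m) here) (Path-∷⁻ p)
  Path-∷⁻ (step (inj₂ (there m)) p) = ViaEdge-prepend (step (inj₂ m) here) (Path-∷⁻ p)
  Path-∷⁻ (step (inj₁ (here refl)) p) with Path-∷⁻ p
  ... | inj₁ q = inj₂ (inj₁ (here , q))
  ... | inj₂ (inj₁ (_ , q)) = inj₂ (inj₁ (here , q))
  ... | inj₂ (inj₂ (_ , q)) = inj₁ q
  Path-∷⁻ (step (inj₂ (here refl)) p) with Path-∷⁻ p
  ... | inj₁ q = inj₂ (inj₂ (here , q))
  ... | inj₂ (inj₁ (_ , q)) = inj₁ q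
  ... | inj₂ (inj₂ (_ , q)) = inj₂ (inj₂ (here , q))

  Path-∷⁺ : ∀ {u v} → ViaEdge u v → Path ((x , y) ∷ F) u v
  Path-∷⁺ (inj₁ q) = Path-∷ q
  Path-∷⁺ (inj₂ (inj₁ (a , b))) = Path-++ (Path-∷ a) (step (inj₁ (here refl)) (Path-∷ b))
  Path-∷⁺ (inj₂ (inj₂ (a , b))) = Path-++ (Path-∷ a) (step (inj₂ (here refl)) (Path-∷ b))

path? : ∀ {n} (F : List (Edge n)) (u v : Fin n) → Dec (Path F u v)
path? [] u v = map′ (λ { refl → here }) Path-[] (u ≟ v)
path? ((x , y) ∷ F) u v = map′ (Path-∷⁺ F x y) (Path-∷⁻ F x y)
  (path? F u v ⊎-dec (path? F u x ×-dec path? F y v) ⊎-dec (path? F u y ×-dec path? F x v))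

connected? : ∀ {n} (F : List (Edge n)) → Dec (Connected F)
connected? F = all? (λ u → all? (λ v → path? F u v))

¬connected⇒unreachable : ∀ {n} (F : List (Edge n)) → ¬ Connected F →
  Σ (Fin n) λ u → Σ (Fin n) λ v → ¬ Path F u v
¬connected⇒unreachable {n} F ¬conn with ¬∀⟶∃¬ n _ (λ u → all? (λ v → path? F u v)) ¬conn
... | u , ¬all with ¬∀⟶∃¬ n _ (λ v → path? F u v) ¬all
... | v , ¬path = u , v , ¬path

data Longest {A : Set} (xs : List A) (P : List A → Set) : Set where
  none    : (∀ ys → ys ⊆ xs → ¬ P ys) → Longest xs P
  longest : (ys : List A) → ys ⊆ xs → P ys →
            (∀ zs → zs ⊆ xs → P zs → length zs ℕ.≤ length ys) → Longest xs P

longest? : {A : Set} (xs : List A) {P : List A → Set} → (∀ ys → Dec (P ys)) → Longest xs P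
longest? [] P? with P? []
... | yes p = longest [] [] p λ { .[] [] _ → z≤n }
... | no ¬p = none λ { .[] [] p → ¬p p }
longest? (x ∷ xs) {P} P? with longest? xs P? | longest? xs {P ∘ (x ∷_)} (P? ∘ (x ∷_))
... | none ¬p | none ¬px = none λ
  { ys (.x ∷ʳ s) p → ¬p ys s p ; (.x ∷ ys) (refl ∷ s) p → ¬px ys s p }
... | longest ys s p max | none ¬px = longest ys (x ∷ʳ s) p λ
  { zs (.x ∷ʳ t) q → max zs t q ; (.x ∷ zs) (refl ∷ t) q → ⊥-elim (¬px zs t q) }
... | none ¬p | longest ys s p max = longest (x ∷ ys) (refl ∷ s) p λ
  { zs (.x ∷ʳ t) q → ⊥-elim (¬p zs t q) ; (.x ∷ zs) (refl ∷ t) q → s≤s (max zs t q) }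
... | longest ys s p max | longest ys′ s′ p′ max′ with length ys ℕ.≤? suc (length ys′)
...   | yes le = longest (x ∷ ys′) (refl ∷ s′) p′ λ
        { zs (.x ∷ʳ t) q → ℕ.≤-trans (max zs t q) le ; (.x ∷ zs) (refl ∷ t) q → s≤s (max′ zs t q) }
...   | no gt = longest ys (x ∷ʳ s) p λ
        { zs (.x ∷ʳ t) q → max zs t q
        ; (.x ∷ zs) (refl ∷ t) q → ℕ.≤-trans (s≤s (max′ zs t q)) (ℕ.<⇒≤ (ℕ.≰⇒> gt)) }

sumFin-cong : ∀ {n} {f g : Fin n → ℕ} → (∀ i → f i ≡ g i) → sumFin f ≡ sumFin g
sumFin-cong {zero} eq = refl
sumFin-cong {suc n} eq = cong₂ ℕ._+_ (eq zero) (sumFin-cong (eq ∘ suc))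

sumFin-mono : ∀ {n} {f g : Fin n → ℕ} → (∀ i → f i ℕ.≤ g i) → sumFin f ℕ.≤ sumFin g
sumFin-mono {zero} le = z≤n
sumFin-mono {suc n} le = ℕ.+-mono-≤ (le zero) (sumFin-mono (le ∘ suc))

sumFin-const : ∀ n k → sumFin {n} (λ _ → k) ≡ k ℕ.* n
sumFin-const zero k = sym (ℕ.*-zeroʳ k)
sumFin-const (suc n) k = begin
  k ℕ.+ sumFin {n} (λ _ → k) ≡⟨ cong (k ℕ.+_) (sumFin-const n k) ⟩
  k ℕ.+ k ℕ.* n              ≡⟨ sym (ℕ.*-suc k n) ⟩
  k ℕ.* suc n                ∎
  where open ≡-Reasoning

sumFin-zero : ∀ {n} {f : Fin n → ℕ} → (∀ i → f i ≡ 0) → sumFin f ≡ 0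
sumFin-zero {zero} eq = refl
sumFin-zero {suc n} eq rewrite eq zero = sumFin-zero (eq ∘ suc)

≤-sumFin : ∀ {n} (f : Fin n → ℕ) v → f v ℕ.≤ sumFin f
≤-sumFin f zero = ℕ.m≤m+n _ _
≤-sumFin f (suc v) = ℕ.≤-trans (≤-sumFin (f ∘ suc) v) (ℕ.m≤n+m _ _)

⌊suc≟suc⌋ : ∀ {n} (i v : Fin n) → ⌊ suc i ≟ suc v ⌋ ≡ ⌊ i ≟ v ⌋
⌊suc≟suc⌋ i v with i ≟ v
... | yes _ = refl
... | no _ = refl

pointMass : ∀ {n} → Fin n → ℕ → Fin n → ℕ
pointMass v k w = if ⌊ w ≟ v ⌋ then k else 0

sumFin-pointMass : ∀ {n} (v : Fin n) k → sumFin (pointMass v k) ≡ k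
sumFin-pointMass {suc n} zero k = trans (cong (k ℕ.+_) (sumFin-zero {n} λ _ → refl)) (ℕ.+-identityʳ k)
sumFin-pointMass {suc n} (suc v) k =
  trans (sumFin-cong λ i → cong (if_then k else 0) (⌊suc≟suc⌋ i v)) (sumFin-pointMass v k)

pointMass-self : ∀ {n} (v : Fin n) k → pointMass v k v ≡ k
pointMass-self v k with v ≟ v
... | yes _ = refl
... | no v≢v = ⊥-elim (v≢v refl)

countIn-∈ : ∀ {n} {A : Subset n} (c : Fin n → ℕ) {v} → v ∈ A → c v ℕ.≤ countIn A c
countIn-∈ c lookup-here = ℕ.m≤m+n _ _
countIn-∈ c (lookup-there v∈A) = ℕ.≤-trans (countIn-∈ (c ∘ suc) v∈A) (ℕ.m≤n+m _ _)

countIn-⁅⁆ : ∀ {n} (v : Fin n) (c : Fin n → ℕ) → countIn ⁅ v ⁆ c ≡ c v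
countIn-⁅⁆ zero c = trans (cong (c zero ℕ.+_) (sumFin-zero outside)) (ℕ.+-identityʳ (c zero))
  where
  outside : ∀ i → (if lookup ⁅ zero ⁆ (suc i) then c (suc i) else 0) ≡ 0
  outside i rewrite lookup-replicate i false = refl
countIn-⁅⁆ (suc v) c = countIn-⁅⁆ v (c ∘ suc)

module _ {A : Set} (p : A → Bool) where

  length-filterᵇ-∷ : ∀ x xs →
    length (filterᵇ p (x ∷ xs)) ≡ (if p x then 1 else 0) ℕ.+ length (filterᵇ p xs)
  length-filterᵇ-∷ x xs with p x
  ... | true = refl
  ... | false = refl

  length-filterᵇ-split : ∀ xs → length xs ≡ length (filterᵇ p xs) ℕ.+ length (filterᵇ (not ∘ p) xs)
  length-filterᵇ-split [] = refl
  length-filterᵇ-split (x ∷ xs) with p x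
  ... | true = cong suc (length-filterᵇ-split xs)
  ... | false = trans (cong suc (length-filterᵇ-split xs)) (sym (ℕ.+-suc _ _))

-- The scramble of singletons

module _ {n : ℕ} (G : Graph n) where

  scramble-hits₂-two : ∀ {S} → Scramble G S → Hits2 S (λ _ → 2)
  scramble-hits₂-two = All.map λ { ((_ , x∈A) , _) → countIn-∈ (λ _ → 2) x∈A }

  scramble-order≤2n : ∀ {S k} → Scramble G S → Order G S k → k ℕ.≤ 2 ℕ.* n
  scramble-order≤2n {S} {k} sc (h , (_ , h-least) , k≡min) = ℕ.≤-trans (k≤h k≡min) h≤2n
    where
    h≤2n : h ℕ.≤ 2 ℕ.* n
    h≤2n = h-least _ ((λ _ → 2) , scramble-hits₂-two sc , sumFin-const n 2)

    k≤h : (Σ ℕ λ e → E2 G S e × k ≡ h ℕ.⊓ e) ⊎ (E2Infinite G S × k ≡ h) → k ℕ.≤ h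
    k≤h (inj₁ (e , _ , refl)) = ℕ.m⊓n≤m h e
    k≤h (inj₂ (_ , refl)) = ℕ.≤-refl

  separates⇒¬connected : ∀ {S R} → Separates G S R → ¬ Connected R
  separates⇒¬connected (_ , _ , _ , _ , _ , a , b , _ , _ , _ , _ , ¬path) conn = ¬path (conn a b)

singletons : ∀ n → List (Subset n)
singletons n = map ⁅_⁆ (allFin n)

⁅⁆∈singletons : ∀ {n} (v : Fin n) → ⁅ v ⁆ ∈ₗ singletons n
⁅⁆∈singletons v = ∈-map⁺ ⁅_⁆ (∈-allFin v)

∈singletons⁻ : ∀ {n} {A : Subset n} → A ∈ₗ singletons n → Σ (Fin n) λ v → A ≡ ⁅ v ⁆
∈singletons⁻ A∈ with ∈-map⁻ ⁅_⁆ A∈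
... | v , _ , A≡⁅v⁆ = v , A≡⁅v⁆

connectedOn-⁅⁆ : ∀ {n} (F : List (Edge n)) v → ConnectedOn F ⁅ v ⁆
connectedOn-⁅⁆ F v u w u∈ w∈ rewrite x∈⁅y⁆⇒x≡y v u∈ | x∈⁅y⁆⇒x≡y v w∈ = here

module _ {n : ℕ} (G : Graph n) where

  singletons-scramble : Scramble G (singletons n)
  singletons-scramble = All.tabulate egg
    where
    egg : ∀ {A} → A ∈ₗ singletons n → Nonempty A × TwoEdgeConnected G A
    egg A∈ with ∈singletons⁻ A∈
    ... | v , refl = (v , x∈⁅x⁆ v) , connectedOn-⁅⁆ _ v , λ _ → connectedOn-⁅⁆ _ v

  h₂-singletons : H2 (singletons n) (2 ℕ.* n)
  h₂-singletons = ((λ _ → 2) , scramble-hits₂-two G singletons-scramble , sumFin-const n 2) , least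
    where
    least : ∀ j → (Σ (Fin n → ℕ) λ c → Hits2 (singletons n) c × sumFin c ≡ j) → 2 ℕ.* n ℕ.≤ j
    least j (c , hits , refl) = subst (ℕ._≤ sumFin c) (sumFin-const n 2) (sumFin-mono two≤c)
      where
      two≤c : ∀ v → 2 ℕ.≤ c v
      two≤c v = subst (2 ℕ.≤_) (countIn-⁅⁆ v c) (All.lookup hits (⁅⁆∈singletons v))

  ¬connected⇒separates-singletons : ∀ {R} → R ⊆ edges G → ¬ Connected R → Separates G (singletons n) R
  ¬connected⇒separates-singletons {R} R⊆ ¬conn with ¬connected⇒unreachable R ¬conn
  ... | u , v , ¬path = R⊆ , ⁅ u ⁆ , ⁅ v ⁆ , ⁅⁆∈singletons u , ⁅⁆∈singletons v , u , v ,
        x∈⁅x⁆ u , x∈⁅x⁆ v , reach u , reach v , ¬path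
    where
    reach : ∀ a x → x ∈ ⁅ a ⁆ → Path R a x
    reach a x x∈ rewrite x∈⁅y⁆⇒x≡y a x∈ = here

  order-singletons : EdgeConnAtLeast G (2 ℕ.* n) → Order G (singletons n) (2 ℕ.* n)
  order-singletons λ≥2n with longest? (edges G) (λ R → ¬? (connected? R))
  ... | none conn = 2 ℕ.* n , h₂-singletons ,
        inj₂ ((λ R sep → conn R (proj₁ sep) (separates⇒¬connected G sep)) , refl)
  ... | longest R R⊆ ¬conn max = 2 ℕ.* n , h₂-singletons ,
        inj₁ (deleted G R , ((R , ¬connected⇒separates-singletons R⊆ ¬conn , refl) , least) ,
              sym (ℕ.m≤n⇒m⊓n≡m (λ≥2n R R⊆ ¬conn)))
    where
    least : ∀ j → (Σ (List (Edge n)) λ R′ → Separates G (singletons n) R′ × deleted G R′ ≡ j) →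
            deleted G R ℕ.≤ j
    least j (R′ , sep , refl) =
      ℕ.∸-monoʳ-≤ (length (edges G)) (max R′ (proj₁ sep) (separates⇒¬connected G sep))

  sn₂-singletons : EdgeConnAtLeast G (2 ℕ.* n) → Sn2 G (2 ℕ.* n)
  sn₂-singletons λ≥2n = (singletons n , singletons-scramble , order-singletons λ≥2n) ,
                        λ k (S , sc , ord) → scramble-order≤2n G sc ord

-- Divisors and the Laplacian

module ChipFiring where

  open import Data.Integer using (_+_; _-_; -_; _≤_; +≤+)
  open import Data.Integer.Properties using (module ≤-Reasoning)

  keep : Bool → ℤ → ℤ
  keep b z = if b then z else + 0

  keep-+ : ∀ b x y → keep b (x + y) ≡ keep b x + keep b y
  keep-+ true x y = refl
  keep-+ false x y = refl

  keep-- : ∀ b x y → keep b (x - y) ≡ keep b x - keep b y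
  keep-- true x y = refl
  keep-- false x y = refl

  keep-0 : ∀ b → keep b (+ 0) ≡ + 0
  keep-0 true = refl
  keep-0 false = refl

  keep-comm : ∀ b c z → keep b (keep c z) ≡ keep c (keep b z)
  keep-comm true c z = refl
  keep-comm false true z = refl
  keep-comm false false z = refl

  keep-split : ∀ b z → keep b z + keep (not b) z ≡ z
  keep-split true z = ℤ.+-identityʳ z
  keep-split false z = ℤ.+-identityˡ z

  keep-nonneg : ∀ b {z} → + 0 ≤ z → + 0 ≤ keep b z
  keep-nonneg true p = p
  keep-nonneg false p = ℤ.≤-refl

  keep-mono : ∀ b {x y} → x ≤ y → keep b x ≤ keep b y
  keep-mono true p = p
  keep-mono false p = ℤ.≤-refl

  sumFinℤ-cong : ∀ {n} {f g : Fin n → ℤ} → (∀ i → f i ≡ g i) → sumFinℤ f ≡ sumFinℤ g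
  sumFinℤ-cong {zero} eq = refl
  sumFinℤ-cong {suc n} eq = cong₂ _+_ (eq zero) (sumFinℤ-cong (eq ∘ suc))

  sumFinℤ-+ : ∀ {n} (f g : Fin n → ℤ) → sumFinℤ (λ i → f i + g i) ≡ sumFinℤ f + sumFinℤ g
  sumFinℤ-+ {zero} f g = refl
  sumFinℤ-+ {suc n} f g = trans (cong (_+_ (f zero + g zero)) (sumFinℤ-+ (f ∘ suc) (g ∘ suc)))
    (interchange (f zero) (g zero) (sumFinℤ (f ∘ suc)) (sumFinℤ (g ∘ suc)))

  -‿+-interchange : ∀ a b c d → (a + b) - (c + d) ≡ (a - c) + (b - d)
  -‿+-interchange = solve-∀

  -‿--interchange : ∀ a b c d → (a - b) - (c - d) ≡ (a - c) - (b - d)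
  -‿--interchange = solve-∀

  [a-b]-c≡a-[b+c] : ∀ a b c → (a - b) - c ≡ a - (b + c)
  [a-b]-c≡a-[b+c] = solve-∀

  [a-b]-c≡[a-c]-b : ∀ a b c → (a - b) - c ≡ (a - c) - b
  [a-b]-c≡[a-c]-b = solve-∀

  a-c≡[a-b]-[c-b] : ∀ a b c → a - c ≡ (a - b) - (c - b)
  a-c≡[a-b]-[c-b] = solve-∀

  [[a-q]-e]-[p-q]≡[a-e]-p : ∀ a q e p → ((a - q) - e) - (p - q) ≡ (a - e) - p
  [[a-q]-e]-[p-q]≡[a-e]-p = solve-∀

  [1+a]-a≡1 : ∀ a → (+ 1 + a) - a ≡ + 1
  [1+a]-a≡1 = solve-∀

  sumFinℤ-- : ∀ {n} (f g : Fin n → ℤ) → sumFinℤ (λ i → f i - g i) ≡ sumFinℤ f - sumFinℤ g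
  sumFinℤ-- {zero} f g = refl
  sumFinℤ-- {suc n} f g = trans (cong (_+_ (f zero - g zero)) (sumFinℤ-- (f ∘ suc) (g ∘ suc)))
    (sym (-‿+-interchange (f zero) (sumFinℤ (f ∘ suc)) (g zero) (sumFinℤ (g ∘ suc))))

  sumFinℤ-zero : ∀ {n} {f : Fin n → ℤ} → (∀ i → f i ≡ + 0) → sumFinℤ f ≡ + 0
  sumFinℤ-zero {zero} eq = refl
  sumFinℤ-zero {suc n} eq = cong₂ _+_ (eq zero) (sumFinℤ-zero (eq ∘ suc))

  sumFinℤ-mono : ∀ {n} {f g : Fin n → ℤ} → (∀ i → f i ≤ g i) → sumFinℤ f ≤ sumFinℤ g
  sumFinℤ-mono {zero} le = ℤ.≤-refl
  sumFinℤ-mono {suc n} le = ℤ.+-mono-≤ (le zero) (sumFinℤ-mono (le ∘ suc))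

  sumFinℤ-nonneg : ∀ {n} {f : Fin n → ℤ} → (∀ i → + 0 ≤ f i) → + 0 ≤ sumFinℤ f
  sumFinℤ-nonneg {n} {f} nonneg =
    subst (_≤ sumFinℤ f) (sumFinℤ-zero {n} λ _ → refl) (sumFinℤ-mono nonneg)

  sumFinℤ-ℕ : ∀ {n} (f : Fin n → ℕ) → sumFinℤ (λ i → + f i) ≡ + sumFin f
  sumFinℤ-ℕ {zero} f = refl
  sumFinℤ-ℕ {suc n} f = cong (_+_ (+ f zero)) (sumFinℤ-ℕ (f ∘ suc))

  sumFinℤ-keep≟ : ∀ {n} (x : Fin n) (g : Fin n → ℤ) → sumFinℤ (λ w → keep ⌊ x ≟ w ⌋ (g w)) ≡ g x
  sumFinℤ-keep≟ {suc n} zero g =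
    trans (cong (_+_ (g zero)) (sumFinℤ-zero {n} λ _ → refl)) (ℤ.+-identityʳ (g zero))
  sumFinℤ-keep≟ {suc n} (suc x) g = begin
    + 0 + sumFinℤ (λ w → keep ⌊ suc x ≟ suc w ⌋ (g (suc w))) ≡⟨ ℤ.+-identityˡ _ ⟩
    sumFinℤ (λ w → keep ⌊ suc x ≟ suc w ⌋ (g (suc w)))       ≡⟨ sumFinℤ-cong (λ w → cong (λ b → keep b (g (suc w))) (⌊suc≟suc⌋ x w)) ⟩
    sumFinℤ (λ w → keep ⌊ x ≟ w ⌋ (g (suc w)))               ≡⟨ sumFinℤ-keep≟ x (g ∘ suc) ⟩
    g (suc x)                                                ∎
    where open ≡-Reasoning

  module _ {n : ℕ} where

    flow : (Fin n → ℤ) → Edge n → Fin n → ℤ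
    flow h (x , y) w = keep ⌊ x ≟ w ⌋ (h x - h y) + keep ⌊ y ≟ w ⌋ (h y - h x)

    -- Lap F h w = Σ over edges wx of (h w − h x): the Laplacian of (Fin n, F) applied to
    -- the firing script h, so firing every x exactly h x times turns D into D − Lap F h.
    Lap : List (Edge n) → (Fin n → ℤ) → Divisor n
    Lap [] h w = + 0
    Lap (e ∷ F) h w = flow h e w + Lap F h w

    flow-+ : ∀ f g e w → flow (λ x → f x + g x) e w ≡ flow f e w + flow g e w
    flow-+ f g (x , y) w = begin
      keep ⌊ x ≟ w ⌋ ((f x + g x) - (f y + g y)) + keep ⌊ y ≟ w ⌋ ((f y + g y) - (f x + g x))
        ≡⟨ cong₂ _+_ (split x (f x) (g x) (f y) (g y)) (split y (f y) (g y) (f x) (g x)) ⟩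
      (keep ⌊ x ≟ w ⌋ (f x - f y) + keep ⌊ x ≟ w ⌋ (g x - g y)) +
      (keep ⌊ y ≟ w ⌋ (f y - f x) + keep ⌊ y ≟ w ⌋ (g y - g x))
        ≡⟨ interchange (keep ⌊ x ≟ w ⌋ (f x - f y)) (keep ⌊ x ≟ w ⌋ (g x - g y))
                       (keep ⌊ y ≟ w ⌋ (f y - f x)) (keep ⌊ y ≟ w ⌋ (g y - g x)) ⟩
      flow f (x , y) w + flow g (x , y) w ∎
      where
      open ≡-Reasoning
      split : ∀ z a b c d → keep ⌊ z ≟ w ⌋ ((a + b) - (c + d)) ≡ keep ⌊ z ≟ w ⌋ (a - c) + keep ⌊ z ≟ w ⌋ (b - d)
      split z a b c d = trans (cong (keep ⌊ z ≟ w ⌋) (-‿+-interchange a b c d)) (keep-+ ⌊ z ≟ w ⌋ _ _)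

    flow-- : ∀ f g e w → flow (λ x → f x - g x) e w ≡ flow f e w - flow g e w
    flow-- f g (x , y) w = begin
      keep ⌊ x ≟ w ⌋ ((f x - g x) - (f y - g y)) + keep ⌊ y ≟ w ⌋ ((f y - g y) - (f x - g x))
        ≡⟨ cong₂ _+_ (split x (f x) (g x) (f y) (g y)) (split y (f y) (g y) (f x) (g x)) ⟩
      (keep ⌊ x ≟ w ⌋ (f x - f y) - keep ⌊ x ≟ w ⌋ (g x - g y)) +
      (keep ⌊ y ≟ w ⌋ (f y - f x) - keep ⌊ y ≟ w ⌋ (g y - g x))
        ≡⟨ sym (-‿+-interchange (keep ⌊ x ≟ w ⌋ (f x - f y)) (keep ⌊ y ≟ w ⌋ (f y - f x))
                                 (keep ⌊ x ≟ w ⌋ (g x - g y)) (keep ⌊ y ≟ w ⌋ (g y - g x))) ⟩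
      flow f (x , y) w - flow g (x , y) w ∎
      where
      open ≡-Reasoning
      split : ∀ z a b c d → keep ⌊ z ≟ w ⌋ ((a - b) - (c - d)) ≡ keep ⌊ z ≟ w ⌋ (a - c) - keep ⌊ z ≟ w ⌋ (b - d)
      split z a b c d = trans (cong (keep ⌊ z ≟ w ⌋) (-‿--interchange a b c d)) (keep-- ⌊ z ≟ w ⌋ _ _)

    Lap-+ : ∀ F f g w → Lap F (λ x → f x + g x) w ≡ Lap F f w + Lap F g w
    Lap-+ [] f g w = refl
    Lap-+ (e ∷ F) f g w = trans (cong₂ _+_ (flow-+ f g e w) (Lap-+ F f g w))
                                (interchange (flow f e w) (flow g e w) (Lap F f w) (Lap F g w))

    Lap-- : ∀ F f g w → Lap F (λ x → f x - g x) w ≡ Lap F f w - Lap F g w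
    Lap-- [] f g w = refl
    Lap-- (e ∷ F) f g w =
      trans (cong₂ _+_ (flow-- f g e w) (Lap-- F f g w))
            (sym (-‿+-interchange (flow f e w) (Lap F f w) (flow g e w) (Lap F g w)))

    Lap-const : ∀ F {h} → (∀ x y → h x ≡ h y) → ∀ w → Lap F h w ≡ + 0
    Lap-const [] eq w = refl
    Lap-const ((x , y) ∷ F) {h} eq w = begin
      keep ⌊ x ≟ w ⌋ (h x - h y) + keep ⌊ y ≟ w ⌋ (h y - h x) + Lap F h w
        ≡⟨ cong₂ (λ a b → keep ⌊ x ≟ w ⌋ a + keep ⌊ y ≟ w ⌋ b + Lap F h w)
                 (ℤ.i≡j⇒i-j≡0 (eq x y)) (ℤ.i≡j⇒i-j≡0 (eq y x)) ⟩
      keep ⌊ x ≟ w ⌋ (+ 0) + keep ⌊ y ≟ w ⌋ (+ 0) + Lap F h w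
        ≡⟨ cong₂ _+_ (cong₂ _+_ (keep-0 ⌊ x ≟ w ⌋) (keep-0 ⌊ y ≟ w ⌋)) (Lap-const F eq w) ⟩
      + 0 ∎
      where open ≡-Reasoning

  incident : ∀ {n} → Fin n → Edge n → Bool
  incident v (x , y) = ⌊ x ≟ v ⌋ ∨ ⌊ y ≟ v ⌋

  joins : ∀ {n} → Fin n → Fin n → Edge n → Bool
  joins v w (x , y) = (⌊ x ≟ v ⌋ ∧ ⌊ y ≟ w ⌋) ∨ (⌊ x ≟ w ⌋ ∧ ⌊ y ≟ v ⌋)

  ⌊⌋∧⌊⌋≡false : ∀ {P Q : Set} (p : Dec P) (q : Dec Q) → (P → ¬ Q) → ⌊ p ⌋ ∧ ⌊ q ⌋ ≡ false
  ⌊⌋∧⌊⌋≡false (yes p) (yes q) excl = ⊥-elim (excl p q)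
  ⌊⌋∧⌊⌋≡false (yes p) (no _) excl = refl
  ⌊⌋∧⌊⌋≡false (no _) _ excl = refl

  -- In the two tables a, b, c, d stand for ⌊ x ≟ v ⌋, ⌊ y ≟ v ⌋, ⌊ x ≟ w ⌋, ⌊ y ≟ w ⌋
  -- for an edge (x , y); the hypotheses say that G is loopless and that v ≢ w.
  flow-unit-self-table : ∀ a b → a ∧ b ≡ false →
    keep a (keep a (+ 1) - keep b (+ 1)) + keep b (keep b (+ 1) - keep a (+ 1)) ≡ + (if a ∨ b then 1 else 0)
  flow-unit-self-table true true ()
  flow-unit-self-table true false _ = refl
  flow-unit-self-table false true _ = refl
  flow-unit-self-table false false _ = refl

  flow-unit-other-table : ∀ a b c d → a ∧ c ≡ false → b ∧ d ≡ false → a ∧ b ≡ false → c ∧ d ≡ false →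
    keep c (keep a (+ 1) - keep b (+ 1)) + keep d (keep b (+ 1) - keep a (+ 1)) ≡
    - + (if (a ∧ d) ∨ (c ∧ b) then 1 else 0)
  flow-unit-other-table true true _ _ _ _ () _
  flow-unit-other-table true false true _ () _ _ _
  flow-unit-other-table true false false true _ _ _ _ = refl
  flow-unit-other-table true false false false _ _ _ _ = refl
  flow-unit-other-table false true c true _ () _ _
  flow-unit-other-table false true true false _ _ _ _ = refl
  flow-unit-other-table false true false false _ _ _ _ = refl
  flow-unit-other-table false false true true _ _ _ ()
  flow-unit-other-table false false true false _ _ _ _ = refl
  flow-unit-other-table false false false true _ _ _ _ = refl
  flow-unit-other-table false false false false _ _ _ _ = refl

  module _ {n : ℕ} where

    unit : Fin n → Fin n → ℤ
    unit v x = keep ⌊ x ≟ v ⌋ (+ 1)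

    Loopless : List (Edge n) → Set
    Loopless = All (λ e → proj₁ e ≢ proj₂ e)

    Lap-unit-self : ∀ v F → Loopless F → Lap F (unit v) v ≡ + length (filterᵇ (incident v) F)
    Lap-unit-self v [] _ = refl
    Lap-unit-self v ((x , y) ∷ F) (x≢y ∷ loopless) = begin
      flow (unit v) (x , y) v + Lap F (unit v) v
        ≡⟨ cong₂ _+_ (flow-unit-self-table ⌊ x ≟ v ⌋ ⌊ y ≟ v ⌋ (⌊⌋∧⌊⌋≡false (x ≟ v) (y ≟ v) λ p q → x≢y (trans p (sym q))))
                     (Lap-unit-self v F loopless) ⟩
      + (if incident v (x , y) then 1 else 0) + + length (filterᵇ (incident v) F)
        ≡⟨ cong +_ (sym (length-filterᵇ-∷ (incident v) (x , y) F)) ⟩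
      + length (filterᵇ (incident v) ((x , y) ∷ F)) ∎
      where open ≡-Reasoning

    Lap-unit-other : ∀ v w → v ≢ w → ∀ F → Loopless F →
      Lap F (unit v) w ≡ - + length (filterᵇ (joins v w) F)
    Lap-unit-other v w v≢w [] _ = refl
    Lap-unit-other v w v≢w ((x , y) ∷ F) (x≢y ∷ loopless) = begin
      flow (unit v) (x , y) w + Lap F (unit v) w
        ≡⟨ cong₂ _+_ (flow-unit-other-table ⌊ x ≟ v ⌋ ⌊ y ≟ v ⌋ ⌊ x ≟ w ⌋ ⌊ y ≟ w ⌋
                        (⌊⌋∧⌊⌋≡false (x ≟ v) (x ≟ w) λ p q → v≢w (trans (sym p) q))
                        (⌊⌋∧⌊⌋≡false (y ≟ v) (y ≟ w) λ p q → v≢w (trans (sym p) q))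
                        (⌊⌋∧⌊⌋≡false (x ≟ v) (y ≟ v) λ p q → x≢y (trans p (sym q)))
                        (⌊⌋∧⌊⌋≡false (x ≟ w) (y ≟ w) λ p q → x≢y (trans p (sym q))))
                     (Lap-unit-other v w v≢w F loopless) ⟩
      - + (if joins v w (x , y) then 1 else 0) - + length (filterᵇ (joins v w) F)
        ≡⟨ sym (ℤ.neg-distrib-+ (+ (if joins v w (x , y) then 1 else 0)) (+ length (filterᵇ (joins v w) F))) ⟩
      - + ((if joins v w (x , y) then 1 else 0) ℕ.+ length (filterᵇ (joins v w) F))
        ≡⟨ cong (-_ ∘ +_) (sym (length-filterᵇ-∷ (joins v w) (x , y) F)) ⟩
      - + length (filterᵇ (joins v w) ((x , y) ∷ F)) ∎
      where open ≡-Reasoning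

    fire≡-Lap-unit : ∀ (G : Graph n) v D w → fire G v D w ≡ D w - Lap (edges G) (unit v) w
    fire≡-Lap-unit G v D w with w ≟ v
    ... | yes refl = cong (_-_ (D w)) (sym (Lap-unit-self w (edges G) (loopless G)))
    ... | no w≢v = begin
      D w + + mult G v w       ≡⟨ cong (_+_ (D w)) (sym (ℤ.neg-involutive _)) ⟩
      D w - - + mult G v w     ≡⟨ cong (_-_ (D w)) (sym (Lap-unit-other v w (w≢v ∘ sym) (edges G) (loopless G))) ⟩
      D w - Lap (edges G) (unit v) w ∎
      where open ≡-Reasoning

    LinEq⇒Lap : ∀ (G : Graph n) {D D′ : Divisor n} → LinEq G D D′ →
      Σ (Fin n → ℤ) λ h → ∀ w → D′ w ≡ D w - Lap (edges G) h w
    LinEq⇒Lap G {D} ε = (λ _ → + 0) , λ w →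
      sym (trans (cong (_-_ (D w)) (Lap-const (edges G) (λ _ _ → refl) w)) (ℤ.+-identityʳ (D w)))
    LinEq⇒Lap G {D} {D′} (_◅_ {j = D₁} (fwd (v , fired)) rest) with LinEq⇒Lap G rest
    ... | h , D′≡ = (λ x → unit v x + h x) , λ w → begin
      D′ w                                                  ≡⟨ D′≡ w ⟩
      D₁ w - Lap E h w                                      ≡⟨ cong (_- Lap E h w) (trans (fired w) (fire≡-Lap-unit G v D w)) ⟩
      (D w - Lap E (unit v) w) - Lap E h w                  ≡⟨ [a-b]-c≡a-[b+c] (D w) (Lap E (unit v) w) (Lap E h w) ⟩
      D w - (Lap E (unit v) w + Lap E h w)                  ≡⟨ cong (_-_ (D w)) (sym (Lap-+ E (unit v) h w)) ⟩
      D w - Lap E (λ x → unit v x + h x) w                  ∎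
      where
      open ≡-Reasoning
      E = edges G
    LinEq⇒Lap G {D} {D′} (_◅_ {j = D₁} (bwd (v , fired)) rest) with LinEq⇒Lap G rest
    ... | h , D′≡ = (λ x → h x - unit v x) , λ w → begin
      D′ w                                                  ≡⟨ D′≡ w ⟩
      D₁ w - Lap E h w                                      ≡⟨ a-c≡[a-b]-[c-b] (D₁ w) (Lap E (unit v) w) (Lap E h w) ⟩
      (D₁ w - Lap E (unit v) w) - (Lap E h w - Lap E (unit v) w)
                                                            ≡⟨ cong (_- (Lap E h w - Lap E (unit v) w)) (sym (trans (fired w) (fire≡-Lap-unit G v D₁ w))) ⟩
      D w - (Lap E h w - Lap E (unit v) w)                  ≡⟨ cong (_-_ (D w)) (sym (Lap-- E h (unit v) w)) ⟩
      D w - Lap E (λ x → h x - unit v x) w                  ∎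
      where
      open ≡-Reasoning
      E = edges G

    sumOver : (Fin n → Bool) → Divisor n → ℤ
    sumOver U D = sumFinℤ (λ w → keep (U w) (D w))

    outflow : (Fin n → Bool) → (Fin n → ℤ) → List (Edge n) → ℤ
    outflow U h [] = + 0
    outflow U h ((x , y) ∷ F) = (keep (U x) (h x - h y) + keep (U y) (h y - h x)) + outflow U h F

    sumOver-+ : ∀ U D D′ → sumOver U (λ w → D w + D′ w) ≡ sumOver U D + sumOver U D′
    sumOver-+ U D D′ = trans (sumFinℤ-cong λ w → keep-+ (U w) (D w) (D′ w))
                             (sumFinℤ-+ (λ w → keep (U w) (D w)) (λ w → keep (U w) (D′ w)))

    sumOver-mono : ∀ U {D D′} → (∀ w → D w ≤ D′ w) → sumOver U D ≤ sumOver U D′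
    sumOver-mono U le = sumFinℤ-mono λ w → keep-mono (U w) (le w)

    sumOver-split : ∀ U D → sumOver U D + sumOver (not ∘ U) D ≡ deg D
    sumOver-split U D = trans (sym (sumFinℤ-+ (λ w → keep (U w) (D w)) (λ w → keep (not (U w)) (D w))))
                               (sumFinℤ-cong λ w → keep-split (U w) (D w))

    sumOver-flow : ∀ U h x y →
      sumOver U (flow h (x , y)) ≡ keep (U x) (h x - h y) + keep (U y) (h y - h x)
    sumOver-flow U h x y = begin
      sumOver U (flow h (x , y))
        ≡⟨ sumOver-+ U _ _ ⟩
      sumFinℤ (λ w → keep (U w) (keep ⌊ x ≟ w ⌋ (h x - h y))) + sumFinℤ (λ w → keep (U w) (keep ⌊ y ≟ w ⌋ (h y - h x)))
        ≡⟨ cong₂ _+_ (sumFinℤ-cong λ w → keep-comm (U w) ⌊ x ≟ w ⌋ _) (sumFinℤ-cong λ w → keep-comm (U w) ⌊ y ≟ w ⌋ _) ⟩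
      sumFinℤ (λ w → keep ⌊ x ≟ w ⌋ (keep (U w) (h x - h y))) + sumFinℤ (λ w → keep ⌊ y ≟ w ⌋ (keep (U w) (h y - h x)))
        ≡⟨ cong₂ _+_ (sumFinℤ-keep≟ x λ w → keep (U w) (h x - h y)) (sumFinℤ-keep≟ y λ w → keep (U w) (h y - h x)) ⟩
      keep (U x) (h x - h y) + keep (U y) (h y - h x) ∎
      where open ≡-Reasoning

    sumOver-Lap : ∀ U h F → sumOver U (Lap F h) ≡ outflow U h F
    sumOver-Lap U h [] = sumFinℤ-zero λ w → keep-0 (U w)
    sumOver-Lap U h ((x , y) ∷ F) =
      trans (sumOver-+ U _ _) (cong₂ _+_ (sumOver-flow U h x y) (sumOver-Lap U h F))

    deg-Lap : ∀ F h → deg (Lap F h) ≡ + 0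
    deg-Lap F h = trans (sumOver-Lap (λ _ → true) h F) (outflow-everything F)
      where
      outflow-everything : ∀ F → outflow (λ _ → true) h F ≡ + 0
      outflow-everything [] = refl
      outflow-everything ((x , y) ∷ F) =
        cong₂ _+_ (trans (ℤ.+-minus-telescope (h x) (h y) (h x)) (ℤ.+-inverseʳ (h x)))
                  (outflow-everything F)

  -- Cuts at the maximum of a firing script

  T-not-xor⇒≡ : ∀ a b → T (not (a xor b)) → a ≡ b
  T-not-xor⇒≡ true true _ = refl
  T-not-xor⇒≡ false false _ = refl

  crosses : ∀ {n} → (Fin n → Bool) → Edge n → Bool
  crosses U (x , y) = U x xor U y

  Path-uncrossed⇒sameSide : ∀ {n} (U : Fin n → Bool) F {u v} →
    Path (filterᵇ (not ∘ crosses U) F) u v → U u ≡ U v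
  Path-uncrossed⇒sameSide U F here = refl
  Path-uncrossed⇒sameSide U F (step (inj₁ e∈) p) =
    trans (T-not-xor⇒≡ _ _ (proj₂ (∈-filter⁻ (T? ∘ (not ∘ crosses U)) {xs = F} e∈))) (Path-uncrossed⇒sameSide U F p)
  Path-uncrossed⇒sameSide U F (step (inj₂ e∈) p) =
    trans (sym (T-not-xor⇒≡ _ _ (proj₂ (∈-filter⁻ (T? ∘ (not ∘ crosses U)) {xs = F} e∈)))) (Path-uncrossed⇒sameSide U F p)

  deleted-uncrossed : ∀ {n} (G : Graph n) U →
    deleted G (filterᵇ (not ∘ crosses U) (edges G)) ≡ length (filterᵇ (crosses U) (edges G))
  deleted-uncrossed G U = trans (cong (ℕ._∸ length uncrossed) (length-filterᵇ-split (crosses U) (edges G)))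
                                (ℕ.m+n∸n≡m (length (filterᵇ (crosses U) (edges G))) (length uncrossed))
    where uncrossed = filterᵇ (not ∘ crosses U) (edges G)

  i<j⇒1≤j-i : ∀ {i j} → i ℤ.< j → + 1 ≤ j - i
  i<j⇒1≤j-i {i} {j} i<j = subst (_≤ j - i) ([1+a]-a≡1 i) (ℤ.+-monoˡ-≤ (- i) (ℤ.i<j⇒suc[i]≤j i<j))

  module MaxLevel {n : ℕ} (h : Fin n → ℤ) (u : Fin n) (h≤hu : ∀ w → h w ≤ h u) where

    top : Fin n → Bool
    top w = ⌊ h w ℤ.≟ h u ⌋

    outflow-edge≥crossing : ∀ x y →
      + (if crosses top (x , y) then 1 else 0) ≤ keep (top x) (h x - h y) + keep (top y) (h y - h x)
    outflow-edge≥crossing x y with h x ℤ.≟ h u | h y ℤ.≟ h u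
    ... | yes hx≡ | yes hy≡ = ℤ.≤-reflexive (sym (trans (ℤ.+-minus-telescope (h x) (h y) (h x)) (ℤ.+-inverseʳ (h x))))
    ... | yes hx≡ | no hy≢ = subst (+ 1 ≤_) (sym (ℤ.+-identityʳ (h x - h y)))
                             (subst (λ z → + 1 ≤ z - h y) (sym hx≡) (i<j⇒1≤j-i (ℤ.≤∧≢⇒< (h≤hu y) hy≢)))
    ... | no hx≢ | yes hy≡ = subst (λ z → + 1 ≤ + 0 + (z - h x)) (sym hy≡)
                             (subst (+ 1 ≤_) (sym (ℤ.+-identityˡ _)) (i<j⇒1≤j-i (ℤ.≤∧≢⇒< (h≤hu x) hx≢)))
    ... | no hx≢ | no hy≢ = ℤ.≤-refl

    outflow≥crossings : ∀ F → + length (filterᵇ (crosses top) F) ≤ outflow top h F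
    outflow≥crossings [] = ℤ.≤-refl
    outflow≥crossings ((x , y) ∷ F) =
      subst (_≤ outflow top h ((x , y) ∷ F)) (cong +_ (sym (length-filterᵇ-∷ (crosses top) (x , y) F)))
            (ℤ.+-mono-≤ (outflow-edge≥crossing x y) (outflow≥crossings F))

  FiresToEffective : ∀ {n} → Graph n → Divisor n → Set
  FiresToEffective {n} G D = Σ (Fin n → ℤ) λ f → Effective (λ w → D w - Lap (edges G) f w)

  equivEffective⇒firesToEffective : ∀ {n} (G : Graph n) {D} → EquivEffective G D → FiresToEffective G D
  equivEffective⇒firesToEffective G (D′ , D~D′ , effD′) with LinEq⇒Lap G D~D′
  ... | f , D′≡ = f , λ w → subst (+ 0 ≤_) (D′≡ w) (effD′ w)

  HeavyProperSet : ∀ {n} → ℕ → Divisor n → Set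
  HeavyProperSet {n} k F = Σ (Fin n → Bool) λ U → (Σ (Fin n) λ v → U v ≡ false) × + k ≤ sumOver U F

  module _ {n : ℕ} (G : Graph n) {k : ℕ} (λ≥k : EdgeConnAtLeast G k) {F : Divisor n} (h : Fin n → ℤ)
           (effAfter : Effective (λ w → F w - Lap (edges G) h w)) where

    -- If h is constant then Lap h = 0. Otherwise each of the ≥ k edges leaving the set
    -- where h is maximal carries at least one chip out of it.
    effective⊎heavy-fromMax : (u : Fin n) → (∀ w → h w ≤ h u) → Effective F ⊎ HeavyProperSet k F
    effective⊎heavy-fromMax u h≤hu with all? (λ w → h w ℤ.≟ h u)
    ... | yes flat = inj₁ λ w → subst (+ 0 ≤_) (F-Lap≡F w) (effAfter w)
      where
      F-Lap≡F : ∀ w → F w - Lap (edges G) h w ≡ F w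
      F-Lap≡F w = trans (cong (_-_ (F w)) (Lap-const (edges G) (λ x y → trans (flat x) (sym (flat y))) w))
                        (ℤ.+-identityʳ (F w))
    ... | no ¬flat with ¬∀⟶∃¬ n _ (λ w → h w ℤ.≟ h u) ¬flat
    ... | u′ , hu′≢ = inj₂ (top , (u′ , top-u′) , bound)
      where
      open MaxLevel h u h≤hu

      top-u′ : top u′ ≡ false
      top-u′ with h u′ ℤ.≟ h u
      ... | yes hu′≡ = ⊥-elim (hu′≢ hu′≡)
      ... | no _ = refl

      top-u : top u ≡ true
      top-u with h u ℤ.≟ h u
      ... | yes _ = refl
      ... | no hu≢hu = ⊥-elim (hu≢hu refl)

      uncrossed : List (Edge n)
      uncrossed = filterᵇ (not ∘ crosses top) (edges G)

      disconnected : ¬ Connected uncrossed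
      disconnected conn with trans (sym top-u) (trans (Path-uncrossed⇒sameSide top (edges G) (conn u u′)) top-u′)
      ... | ()

      bound : + k ≤ sumOver top F
      bound = begin
        + k                                         ≤⟨ +≤+ (subst (k ℕ.≤_) (deleted-uncrossed G top)
                                                           (λ≥k uncrossed (filter-⊆ (T? ∘ (not ∘ crosses top)) (edges G)) disconnected)) ⟩
        + length (filterᵇ (crosses top) (edges G)) ≤⟨ outflow≥crossings (edges G) ⟩
        outflow top h (edges G)                     ≡⟨ sym (sumOver-Lap top h (edges G)) ⟩
        sumOver top (Lap (edges G) h)               ≤⟨ sumOver-mono top (λ w → ℤ.0≤i-j⇒j≤i (effAfter w)) ⟩
        sumOver top F                               ∎
        where open ≤-Reasoning

  effective⊎heavy : ∀ {n} (G : Graph n) {k} → EdgeConnAtLeast G k → ∀ {F} →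
    FiresToEffective G F → Effective F ⊎ HeavyProperSet k F
  effective⊎heavy {zero} G λ≥k _ = inj₁ λ ()
  effective⊎heavy {suc m} G λ≥k (h , effAfter) = effective⊎heavy-fromMax G λ≥k h effAfter u h≤hu
    where
    u : Fin (suc m)
    u = argmax h zero (allFin (suc m))

    h≤hu : ∀ w → h w ≤ h u
    h≤hu w = v≤f[argmax]⁺ {f = h} zero (allFin (suc m)) (inj₂ (lose (∈-allFin w) ℤ.≤-refl))

  module _ {n : ℕ} (G : Graph n) where

    firesToEffective-weaken : ∀ (D : Divisor n) (E : Fin n → ℕ) →
      FiresToEffective G (λ w → D w - + E w) → FiresToEffective G D
    firesToEffective-weaken D E (f , eff) = f , λ w →
      ℤ.≤-trans (eff w) (subst (_≤ D w - Lap (edges G) f w) (sym ([a-b]-c≡[a-c]-b (D w) (+ E w) (Lap (edges G) f w)))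
                                 (ℤ.i-j≤i (D w - Lap (edges G) f w) (+ E w)))

    firesToEffective-rebase : ∀ (D : Divisor n) (E : Fin n → ℕ) (g : Fin n → ℤ) →
      FiresToEffective G (λ w → D w - + E w) → FiresToEffective G (λ w → (D w - Lap (edges G) g w) - + E w)
    firesToEffective-rebase D E g (f , eff) = (λ x → f x - g x) , λ w →
      subst (+ 0 ≤_) (sym (trans (cong (_-_ ((D w - Lap (edges G) g w) - + E w)) (Lap-- (edges G) f g w))
                                 ([[a-q]-e]-[p-q]≡[a-e]-p (D w) (Lap (edges G) g w) (+ E w) (Lap (edges G) f w))))
            (eff w)

  ≤-sumOver : ∀ {n} U (D : Divisor n) {v} → Effective D → U v ≡ true → D v ≤ sumOver U D
  ≤-sumOver U D {v} eff Uv = subst (_≤ sumOver U D) (sumFinℤ-keep≟ v D) (sumFinℤ-mono pointwise)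
    where
    pointwise : ∀ w → keep ⌊ v ≟ w ⌋ (D w) ≤ keep (U w) (D w)
    pointwise w with v ≟ w
    ... | yes refl rewrite Uv = ℤ.≤-refl
    ... | no _ = keep-nonneg (U w) (eff w)

  sumOver≤deg : ∀ {n} U (D : Divisor n) → Effective D → sumOver U D ≤ deg D
  sumOver≤deg U D eff = subst (sumOver U D ≤_) (sumOver-split U D)
    (subst (_≤ sumOver U D + sumOver (not ∘ U) D) (ℤ.+-identityʳ (sumOver U D))
       (ℤ.+-monoʳ-≤ (sumOver U D) (sumFinℤ-nonneg λ w → keep-nonneg (not (U w)) (eff w))))

  sumOver+outside≤deg : ∀ {n} U (D : Divisor n) {v} → Effective D → U v ≡ false → sumOver U D + D v ≤ deg D
  sumOver+outside≤deg U D {v} eff Uv = subst (sumOver U D + D v ≤_) (sumOver-split U D)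
    (ℤ.+-monoʳ-≤ (sumOver U D) (≤-sumOver (not ∘ U) D eff (cong not Uv)))

  -- The divisor 2·𝟙

  module _ {n : ℕ} (G : Graph n) (λ≥2n : EdgeConnAtLeast G (2 ℕ.* n)) where

    allTwos : Divisor n
    allTwos _ = + 2

    deg-allTwos : deg allTwos ≡ + (2 ℕ.* n)
    deg-allTwos = trans (sumFinℤ-ℕ {n} (λ _ → 2)) (cong +_ (sumFin-const n 2))

    rankProp-allTwos-2 : RankProp G allTwos 2
    rankProp-allTwos-2 E degE = (λ v → + 2 - + E v) , ε ,
      λ v → ℤ.i≤j⇒0≤j-i (+≤+ (subst (E v ℕ.≤_) degE (≤-sumFin E v)))

    -- A heavy proper set U would hold 2n chips of 2·𝟙 − j(v) ≤ 2·𝟙, but 2·𝟙 has only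
    -- 2n − 2 chips on U.
    rankProp-allTwos⇒≤2 : Fin n → ∀ j → RankProp G allTwos j → j ℕ.≤ 2
    rankProp-allTwos⇒≤2 v j rp
      with effective⊎heavy G λ≥2n (equivEffective⇒firesToEffective G (rp (pointMass v j) (sumFin-pointMass v j)))
    ... | inj₁ eff = ℤ.drop‿+≤+ (ℤ.0≤i-j⇒j≤i (subst (λ z → + 0 ≤ + 2 - + z) (pointMass-self v j) (eff v)))
    ... | inj₂ (U , (u′ , Uu′) , heavy) = ⊥-elim (ℕ.m+1+n≰m (2 ℕ.* n) (ℤ.drop‿+≤+ tooMany))
      where
      tooMany : + (2 ℕ.* n) + + 2 ≤ + (2 ℕ.* n)
      tooMany = begin
        + (2 ℕ.* n) + + 2        ≤⟨ ℤ.+-monoˡ-≤ (+ 2) (ℤ.≤-trans heavy (sumOver-mono U λ w → ℤ.i-j≤i (+ 2) (+ pointMass v j w))) ⟩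
        sumOver U allTwos + + 2  ≤⟨ sumOver+outside≤deg U allTwos (λ _ → +≤+ z≤n) Uu′ ⟩
        deg allTwos              ≡⟨ deg-allTwos ⟩
        + (2 ℕ.* n)              ∎
        where open ≤-Reasoning

    rank-allTwos : Fin n → Rank G allTwos (+ 2)
    rank-allTwos v = inj₂ (2 , refl , rankProp-allTwos-2 , rankProp-allTwos⇒≤2 v)

    -- At a vertex v with D v < 2 the divisor D − k(v) is not effective, so it has a
    -- heavy proper set.
    firesToEffective⇒deg≥2n : ∀ {D k} → Effective D →
      (∀ v → FiresToEffective G (λ w → D w - + pointMass v k w)) → 2 ℕ.≤ k → + (2 ℕ.* n) ≤ deg D
    firesToEffective⇒deg≥2n {D} {k} effD fires 2≤k with all? (λ v → + 2 ℤ.≤? D v)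
    ... | yes allTwos≤D = subst (_≤ deg D) deg-allTwos (sumFinℤ-mono allTwos≤D)
    ... | no ¬allTwos≤D with ¬∀⟶∃¬ n _ (λ v → + 2 ℤ.≤? D v) ¬allTwos≤D
    ... | v , 2≰Dv with effective⊎heavy G λ≥2n (fires v)
    ... | inj₁ eff = ⊥-elim (2≰Dv (ℤ.≤-trans (+≤+ 2≤k)
                       (ℤ.0≤i-j⇒j≤i (subst (λ z → + 0 ≤ D v - + z) (pointMass-self v k) (eff v)))))
    ... | inj₂ (U , _ , heavy) = begin
        + (2 ℕ.* n)                                ≤⟨ heavy ⟩
        sumOver U (λ w → D w - + pointMass v k w)  ≤⟨ sumOver-mono U (λ w → ℤ.i-j≤i (D w) (+ pointMass v k w)) ⟩
        sumOver U D                                ≤⟨ sumOver≤deg U D effD ⟩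
        deg D                                      ∎
      where open ≤-Reasoning

    rankProp≥2⇒deg≥2n : Fin n → ∀ D k → RankProp G D k → 2 ℕ.≤ k → + (2 ℕ.* n) ≤ deg D
    rankProp≥2⇒deg≥2n v₀ D k rp 2≤k = subst (+ (2 ℕ.* n) ≤_) deg-D₀ (firesToEffective⇒deg≥2n effD₀ fires₀ 2≤k)
      where
      firesMinus : ∀ v → FiresToEffective G (λ w → D w - + pointMass v k w)
      firesMinus v = equivEffective⇒firesToEffective G (rp (pointMass v k) (sumFin-pointMass v k))

      firesD : FiresToEffective G D
      firesD = firesToEffective-weaken G D (pointMass v₀ k) (firesMinus v₀)

      D₀ : Divisor n
      D₀ w = D w - Lap (edges G) (proj₁ firesD) w

      effD₀ : Effective D₀
      effD₀ = proj₂ firesD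

      fires₀ : ∀ v → FiresToEffective G (λ w → D₀ w - + pointMass v k w)
      fires₀ v = firesToEffective-rebase G D (pointMass v k) (proj₁ firesD) (firesMinus v)

      deg-D₀ : deg D₀ ≡ deg D
      deg-D₀ = trans (sumFinℤ-- D (Lap (edges G) (proj₁ firesD)))
                     (trans (cong (_-_ (deg D)) (deg-Lap (edges G) (proj₁ firesD))) (ℤ.+-identityʳ (deg D)))

    gon₂-allTwos : Fin n → Gon2 G (+ (2 ℕ.* n))
    gon₂-allTwos v₀ = (allTwos , deg-allTwos , + 2 , rank-allTwos v₀ , ℤ.≤-refl) , least
      where
      least : ∀ d → (Σ (Divisor n) λ D → deg D ≡ d × Σ ℤ λ r → Rank G D r × + 2 ≤ r) → + (2 ℕ.* n) ≤ d
      least d (D , refl , _ , inj₁ (refl , _) , ())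
      least d (D , refl , _ , inj₂ (k , refl , rp , _) , 2≤k) = rankProp≥2⇒deg≥2n v₀ D k rp (ℤ.drop‿+≤+ 2≤k)

open ChipFiring using (gon₂-allTwos)
open import Data.Nat using (_*_; _≤_)

corollary5p3 : (n : ℕ) → 1 ≤ n → (G : Graph n) → EdgeConnAtLeast G (2 * n) →
    Sn2 G (2 * n) × Gon2 G (+ (2 * n))
corollary5p3 n 1≤n G λ≥2n = sn₂-singletons G λ≥2n , gon₂-allTwos G λ≥2n (fromℕ< 1≤n)
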